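{- Let $\mathcal F=(S_0\subseteq S_1\subseteq\cdots\subseteq S_k)$ be a restricted flag of $[n]$ of type $t=(t_1,\dots,t_k)$. The number of bonsai sequences $(B_1,\dots,B_k)$ whose associated restricted flag is $\mathcal F$ equals $t_1^{t_1-2}t_2^{t_2-2}\cdots t_k^{t_k-2}$.
   Context: A restricted flag of $[n]=\{1,\dots,n\}$ of length $k$ is a chain $\emptyset=S_0\subseteq S_1\subseteq\cdots\subseteq S_k=[n]$ with $\max S_{i+1}\notin S_i$ for $i=1,\dots,k-1$; its type is $(t_1,\dots,t_k)$ with $t_i=|S_i\setminus S_{i-1}|\ge1$. A bonsai is a rooted labelled tree whose root has the largest label (equivalently, the root is its only record). A bonsai sequence on $[n]$ is a sequence $(B_1,\dots,B_k)$ of bonsais with pairwise disjoint label sets whose union is $[n]$, ordered so that root labels increase; its associated restricted flag is given by $S_i=$ the set of labels of $B_1\cup\cdots\cup B_i$. The value $1^{ -1}$ is read as $1$. -}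

module Defs where

open import Data.Nat using (ℕ; zero; suc; _∸_; _^_; _*_)
open import Data.Fin using (Fin; _<_; _≤_; toℕ) renaming (suc to fsuc; zero to fzero)
open import Data.Fin.Subset using (Subset; _∈_; _∉_; _⊆_; _∪_; _∩_; _─_; ∣_∣; ⊥; ⊤; Empty)
open import Data.Vec using (Vec; []; _∷_; lookup; map)
open import Data.Maybe using (Maybe; just; nothing; _>>=_)
open import Data.Product using (Σ; _×_; _,_; ∃; ∃-syntax; proj₁; proj₂)
open import Data.Unit using () renaming (⊤ to Unit)
import Data.List
import Data.Vec as V
import Data.Fin as F
open import Relation.Binary.PropositionalEquality using (_≡_; _≢_)
open import Data.List using (List)
open import Data.List.Membership.Propositional using () renaming (_∈_ to _∈ₗ_)
open import Data.List.Relation.Unary.Unique.Propositional using (Unique)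
open import Function.Bundles using (_⇔_)

variable
  n k : ℕ

-- Flags of [n] (labels are Fin n, i.e. [n] shifted by one; order preserved)

IsMaxOf : Fin n → Subset n → Set
IsMaxOf m T = m ∈ T × (∀ x → x ∈ T → x ≤ m)

IsChain : Vec (Subset n) (suc k) → Set
IsChain (_ ∷ []) = Unit
IsChain (a ∷ b ∷ rest) = a ⊆ b × IsChain (b ∷ rest)

-- max S_{i+1} ∉ S_i for i = 1, ..., k-1
-- (the vector starts at S_1 here)
MaxCond : Vec (Subset n) (suc k) → Set
MaxCond (_ ∷ []) = Unit
MaxCond (a ∷ b ∷ rest) = (Σ _ λ m → IsMaxOf m b × m ∉ a) × MaxCond (b ∷ rest)

flagType : Vec (Subset n) (suc k) → Vec ℕ k
flagType (_ ∷ []) = []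
flagType (a ∷ b ∷ rest) = ∣ b ─ a ∣ ∷ flagType (b ∷ rest)

IsRestrictedFlag : Vec (Subset n) (suc k) → Set
IsRestrictedFlag {k = zero} F = lookup F fzero ≡ ⊥ × lookup F fzero ≡ ⊤ × IsChain F
IsRestrictedFlag {k = suc k} (S₀ ∷ rest) =
  S₀ ≡ ⊥ × lookup rest (F.fromℕ k) ≡ ⊤ × IsChain (S₀ ∷ rest)
  × (∀ i → 1 Data.Nat.≤ lookup (flagType (S₀ ∷ rest)) i)
  × MaxCond rest

-- A tree on label set L is given by (L , p) with p : Vec (Maybe (Fin n)) n,
-- p[i] = parent of i; p[i] = nothing for the root and for labels outside L.

BonsaiData : ℕ → Set
BonsaiData n = Subset n × Vec (Maybe (Fin n)) n

labels : BonsaiData n → Subset n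
labels = proj₁

parentVec : BonsaiData n → Vec (Maybe (Fin n)) n
parentVec = proj₂

climb : Vec (Maybe (Fin n)) n → ℕ → Maybe (Fin n) → Maybe (Fin n)
climb p zero x = x
climb p (suc m) x = climb p m (x >>= lookup p)

IsRootedTree : BonsaiData n → Fin n → Set
IsRootedTree (L , p) r =
    r ∈ L
  × lookup p r ≡ nothing
  × (∀ i → i ∉ L → lookup p i ≡ nothing)
  × (∀ i → i ∈ L → i ≢ r → Σ _ λ j → lookup p i ≡ just j × j ∈ L)
  × (∀ i → i ∈ L → ∃[ m ] climb p m (just i) ≡ just r)

IsBonsai : BonsaiData n → Set
IsBonsai B = Σ _ λ r → IsRootedTree B r × IsMaxOf r (labels B)

prefixUnions : Vec (Subset n) k → Vec (Subset n) (suc k)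
prefixUnions [] = ⊥ ∷ []
prefixUnions (x ∷ xs) = ⊥ ∷ map (x ∪_) (prefixUnions xs)

associatedFlag : Vec (BonsaiData n) k → Vec (Subset n) (suc k)
associatedFlag Bs = prefixUnions (map labels Bs)

IsBonsaiSequence : Vec (BonsaiData n) k → Set
IsBonsaiSequence {n} {k} Bs =
    (∀ i → IsBonsai (lookup Bs i))
  × (∀ i j → i ≢ j → Empty (labels (lookup Bs i) ∩ labels (lookup Bs j)))
  × V.foldr (λ _ → Subset n) _∪_ ⊥ (map labels Bs) ≡ ⊤
  × (∀ i j → i < j → ∀ r r' → IsRootedTree (lookup Bs i) r → IsRootedTree (lookup Bs j) r' → r < r')

productPow : Vec ℕ k → ℕ
productPow [] = 1
productPow (t ∷ ts) = (t ^ (t ∸ 2)) * productPow ts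

HasCount : {A : Set} → (A → Set) → ℕ → Set
HasCount {A} P N = Σ (List A) λ xs → Unique xs × (∀ x → (P x ⇔ x ∈ₗ xs)) × Data.List.length xs ≡ N

-- The blocks S_i ∖ S_{i-1} of a restricted flag determine the flag, and a bonsai sequence
-- with associated flag F amounts to one bonsai on each block of F: since max S_{i+1} ∉ S_i,
-- the largest label of a block exceeds every label of the earlier blocks, so the roots
-- increase automatically. A bonsai on a block of size t is a tree on t labelled vertices
-- with a prescribed root, and these are counted by Prüfer codes: cutting off the greatest
-- leaf and recording its parent, |A| − 1 times, turns a tree on A ∪ {r} rooted at r ∉ A
-- into a word of length |A| − 1 over A ∪ {r}; the leaf cut off at each step is the greatest
-- vertex of A not occurring in the rest of the word, so the tree can be rebuilt from the
-- word, and there are (|A| + 1)^(|A| − 1) = t^(t−2) words.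

module Submission where

open import Defs
open import Data.Bool using (true; false; if_then_else_)
open import Data.Empty using (⊥-elim)
open import Data.Fin as Fin using (Fin; zero; suc; _≟_; toℕ; inject₁; fromℕ)
import Data.Fin.Properties as Fin
open import Data.Fin.Subset
  using (Subset; _∈_; _∉_; _─_; _-_; ⁅_⁆; ∣_∣; ⊥; ⊤; _∪_; _∩_; _⊆_; Empty; Nonempty)
open import Data.Fin.Subset.Properties
  using (_∈?_; p─q⊆p; x∈p∧x≢y⇒x∈p-y; x∈p∧x∉q⇒x∈p─q; x∉⁅y⁆⇒x≢y; p─⊥≡p;
         Empty-unique; ∣⊥∣≡0; nonempty?;
         x∈p∪q⁻; x∈p∪q⁺; ∉⊥; x∈p∩q⁻; x∈p∩q⁺; ⊆-antisym; ∪-identityˡ; ∪-identityʳ; ∪-assoc)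
open import Data.List using (List; []; _∷_; _++_; map; length; cartesianProductWith)
import Data.List.Properties as List
open import Data.List.Membership.Propositional using () renaming (_∈_ to _∈ₗ_; _∉_ to _∉ₗ_)
open import Data.List.Membership.Propositional.Properties
  using (∈-map⁺; ∈-map⁻; ∈-cartesianProductWith⁺; ∈-cartesianProductWith⁻)
import Data.List.Membership.DecPropositional as DecMembership
open import Data.List.Relation.Unary.All as All using (All; []; _∷_)
open import Data.List.Relation.Unary.Any using (here; there)
open import Data.List.Relation.Unary.Any.Properties using (¬Any[])
open import Data.List.Relation.Unary.Unique.Propositional using (Unique; []; _∷_)
import Data.List.Relation.Unary.Unique.Propositional.Properties as Unique
open import Data.Maybe using (Maybe; just; nothing; fromMaybe)
import Data.Maybe.Properties as Maybe
open import Data.Nat as ℕ using (ℕ; zero; suc; _+_; _*_; _∸_; _^_; _≤_; _<_; z≤n; s≤s)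
import Data.Nat.Properties as ℕ
open import Data.Product using (_×_; _,_; ∃; ∃₂; proj₁; proj₂; uncurry)
open import Data.Product.Function.NonDependent.Propositional using (_×-⇔_)
open import Data.Sum using (_⊎_; inj₁; inj₂; [_,_]′; map₂; swap)
open import Data.Sum.Function.Propositional using (_⊎-⇔_)
open import Data.Vec as Vec using (Vec; []; _∷_; here; there; lookup; head; tabulate; _[_]≔_)
open import Data.Vec.Properties as Vec
  using (lookup-map; map-∘; map-cong; map-id; lookup∘tabulate; tabulate∘lookup; tabulate-cong;
         lookup∘update; lookup∘update′; []≔-idempotent; []≔-lookup)
open import Data.Vec.Relation.Binary.Pointwise.Inductive as Pointwise using (Pointwise; []; _∷_)
open import Function using (_∘_; _∘′_)
open import Function.Bundles using (_⇔_; mk⇔; Equivalence)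
import Function.Properties.Equivalence as ⇔
open import Function.Related.Propositional using (module EquationalReasoning)
open import Relation.Binary using (tri<; tri≈; tri>)
open import Relation.Binary.PropositionalEquality
open import Relation.Nullary using (¬_; yes; no; does)
open import Relation.Nullary.Decidable using (_×-dec_; _→-dec_; ¬?; toSum)
open import Relation.Unary using (Decidable)

open Equivalence using (to; from)

-- Counting

HasCount-resp : {A : Set} {P Q : A → Set} {N : ℕ} → (∀ x → P x ⇔ Q x) → HasCount P N → HasCount Q N
HasCount-resp P⇔Q (xs , unique , P⇔∈ , len) =
  xs , unique , (λ x → mk⇔ (to (P⇔∈ x) ∘′ from (P⇔Q x)) (to (P⇔Q x) ∘′ from (P⇔∈ x))) , len

HasCount-singleton : {A : Set} (a : A) → HasCount (_≡ a) 1
HasCount-singleton a = a ∷ [] , [] ∷ [] , (λ x → mk⇔ here λ { (here x≡a) → x≡a ; (there ()) }) , refl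

HasCount-image : {A B : Set} {P : A → Set} {N : ℕ} (f : A → B) → (∀ {x y} → f x ≡ f y → x ≡ y) →
  HasCount P N → HasCount (λ z → ∃ λ x → P x × f x ≡ z) N
HasCount-image f f-injective (xs , unique , P⇔∈ , len) =
  map f xs , Unique.map⁺ f-injective unique ,
  (λ z → mk⇔ (λ { (x , px , refl) → ∈-map⁺ f (to (P⇔∈ x) px) })
              (λ z∈ → let x , x∈ , z≡fx = ∈-map⁻ f z∈ in x , from (P⇔∈ x) x∈ , sym z≡fx)) ,
  trans (List.length-map f xs) len

HasCount-insert : {A : Set} {P : A → Set} {N : ℕ} (a : A) → ¬ P a →
  HasCount P N → HasCount (λ x → x ≡ a ⊎ P x) (suc N)
HasCount-insert {P = P} a ¬pa (xs , unique , P⇔∈ , len) =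
  a ∷ xs , All.tabulate (λ x∈ a≡x → ¬pa (subst P (sym a≡x) (from (P⇔∈ _) x∈))) ∷ unique ,
  (λ x → mk⇔ (λ { (inj₁ x≡a) → here x≡a ; (inj₂ px) → there (to (P⇔∈ x) px) })
              (λ { (here x≡a) → inj₁ x≡a ; (there x∈) → inj₂ (from (P⇔∈ x) x∈) })) ,
  cong suc len

HasCount-bijection : {A B : Set} {P : A → Set} {Q : B → Set} {N : ℕ} (f : A → B) (g : B → A) →
  (∀ x → P x → Q (f x)) → (∀ y → Q y → P (g y)) →
  (∀ x → P x → g (f x) ≡ x) → (∀ y → Q y → f (g y) ≡ y) →
  HasCount Q N → HasCount P N
HasCount-bijection {P = P} f g PQ QP gf fg (ys , unique , Q⇔∈ , len) =
  map g ys , Unique.map⁻ (subst Unique (sym fgys) unique) , P⇔∈ , trans (List.length-map g ys) len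
  where
  fgys : map f (map g ys) ≡ ys
  fgys = trans (sym (List.map-∘ ys)) (List.map-id-local (All.tabulate λ y∈ → fg _ (from (Q⇔∈ _) y∈)))
  P⇔∈ : ∀ x → P x ⇔ x ∈ₗ map g ys
  P⇔∈ x = mk⇔ (λ px → subst (_∈ₗ map g ys) (gf x px) (∈-map⁺ g (to (Q⇔∈ (f x)) (PQ x px))))
              (λ x∈ → let y , y∈ , x≡gy = ∈-map⁻ g x∈ in subst P (sym x≡gy) (QP y (from (Q⇔∈ y) y∈)))

length-cartesianProductWith : {A B C : Set} (f : A → B → C) (xs : List A) (ys : List B) →
  length (cartesianProductWith f xs ys) ≡ length xs * length ys
length-cartesianProductWith f [] ys = refl
length-cartesianProductWith f (x ∷ xs) ys = begin
  length (map (f x) ys ++ cartesianProductWith f xs ys)  ≡⟨ List.length-++ (map (f x) ys) ⟩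
  length (map (f x) ys) + length (cartesianProductWith f xs ys)
    ≡⟨ cong₂ _+_ (List.length-map (f x) ys) (length-cartesianProductWith f xs ys) ⟩
  length ys + length xs * length ys  ∎
  where open ≡-Reasoning

HasCount-image₂ : {A B C : Set} {P : A → Set} {Q : B → Set} {a b : ℕ} (f : A → B → C) →
  (∀ {x x′ y y′} → f x y ≡ f x′ y′ → x ≡ x′ × y ≡ y′) →
  HasCount P a → HasCount Q b → HasCount (λ z → ∃₂ λ x y → P x × Q y × f x y ≡ z) (a * b)
HasCount-image₂ f f-injective (xs , uxs , P⇔∈ , lxs) (ys , uys , Q⇔∈ , lys) =
  cartesianProductWith f xs ys ,
  Unique.cartesianProductWith⁺ f f-injective uxs uys ,
  (λ z → mk⇔ (λ { (x , y , px , qy , refl) → ∈-cartesianProductWith⁺ f (to (P⇔∈ x) px) (to (Q⇔∈ y) qy) })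
              (λ z∈ → let x , y , x∈ , y∈ , z≡ = ∈-cartesianProductWith⁻ f xs ys z∈
                      in x , y , from (P⇔∈ x) x∈ , from (Q⇔∈ y) y∈ , sym z≡)) ,
  trans (length-cartesianProductWith f xs ys) (cong₂ _*_ lxs lys)

HasCount-lists : {A : Set} {Q : A → Set} {N : ℕ} → HasCount Q N →
  ∀ L → HasCount (λ ds → length ds ≡ L × All Q ds) (N ^ L)
HasCount-lists countQ zero =
  HasCount-resp (λ { [] → mk⇔ (λ _ → refl , []) (λ _ → refl)
                   ; (_ ∷ _) → mk⇔ (λ ()) λ { (() , _) } })
    (HasCount-singleton [])
HasCount-lists {Q = Q} countQ (suc L) =
  HasCount-resp (λ ds → mk⇔ (λ { (x , ys , qx , (len , qys) , refl) → cong suc len , qx ∷ qys })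
                            (cons⁻ ds))
    (HasCount-image₂ _∷_ List.∷-injective countQ (HasCount-lists countQ L))
  where
  cons⁻ : ∀ ds → length ds ≡ suc L × All Q ds →
          ∃₂ λ x ys → Q x × (length ys ≡ L × All Q ys) × x ∷ ys ≡ ds
  cons⁻ (x ∷ ys) (len , qx ∷ qys) = x , ys , qx , (ℕ.suc-injective len , qys) , refl

HasCount-Pointwise : {k : ℕ} {A B : Set} {R : A → B → Set} (w : A → ℕ) (xs : Vec A k) →
  (∀ i → HasCount (R (lookup xs i)) (w (lookup xs i))) →
  HasCount (λ (ys : Vec B k) → Pointwise R xs ys) (Vec.foldr′ _*_ 1 (Vec.map w xs))
HasCount-Pointwise w [] count =
  HasCount-resp (λ { [] → mk⇔ (λ _ → []) (λ _ → refl) }) (HasCount-singleton [])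
HasCount-Pointwise w (x ∷ xs) count =
  HasCount-resp (λ ys → mk⇔ (λ { (y , ys , rxy , rxsys , refl) → rxy ∷ rxsys })
                            (λ { (rxy ∷ rxsys) → _ , _ , rxy , rxsys , refl }))
    (HasCount-image₂ _∷_ Vec.∷-injective (count zero) (HasCount-Pointwise w xs (λ i → count (suc i))))

-- Finite subsets and greatest elements

x∈p─q⇒x∉q : {n : ℕ} {x : Fin n} (p q : Subset n) → x ∈ p ─ q → x ∉ q
x∈p─q⇒x∉q {x = zero} (s ∷ p) (true ∷ q) ()
x∈p─q⇒x∉q {x = zero} (s ∷ p) (false ∷ q) here ()
x∈p─q⇒x∉q {x = suc x} (s ∷ p) (t ∷ q) (there x∈) (there x∈q) = x∈p─q⇒x∉q p q x∈ x∈q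

x∈p-y⇒x≢y : {n : ℕ} {x y : Fin n} (p : Subset n) → x ∈ p - y → x ≢ y
x∈p-y⇒x≢y {y = y} p x∈ = x∉⁅y⁆⇒x≢y (x∈p─q⇒x∉q p ⁅ y ⁆ x∈)

∣p∣≡1+∣p-x∣ : {n : ℕ} {x : Fin n} (p : Subset n) → x ∈ p → ∣ p ∣ ≡ suc ∣ p - x ∣
∣p∣≡1+∣p-x∣ {x = zero} (true ∷ p) here = cong (suc ∘ ∣_∣) (sym (p─⊥≡p p))
∣p∣≡1+∣p-x∣ {x = suc x} (true ∷ p) (there x∈) = cong suc (∣p∣≡1+∣p-x∣ p x∈)
∣p∣≡1+∣p-x∣ {x = suc x} (false ∷ p) (there x∈) = ∣p∣≡1+∣p-x∣ p x∈

∣p∣≤1+∣p-x∣ : {n : ℕ} (x : Fin n) (p : Subset n) → ∣ p ∣ ≤ suc ∣ p - x ∣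
∣p∣≤1+∣p-x∣ zero (true ∷ p) = ℕ.≤-reflexive (cong suc (cong ∣_∣ (sym (p─⊥≡p p))))
∣p∣≤1+∣p-x∣ zero (false ∷ p) = ℕ.m≤n⇒m≤1+n (ℕ.≤-reflexive (cong ∣_∣ (sym (p─⊥≡p p))))
∣p∣≤1+∣p-x∣ (suc x) (true ∷ p) = s≤s (∣p∣≤1+∣p-x∣ x p)
∣p∣≤1+∣p-x∣ (suc x) (false ∷ p) = ∣p∣≤1+∣p-x∣ x p

Empty⇒∣p∣≡0 : {n : ℕ} {p : Subset n} → Empty p → ∣ p ∣ ≡ 0
Empty⇒∣p∣≡0 {n} empty = trans (cong ∣_∣ (Empty-unique empty)) (∣⊥∣≡0 n)

∣p∣>0⇒Nonempty : {n : ℕ} (p : Subset n) → 0 < ∣ p ∣ → Nonempty p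
∣p∣>0⇒Nonempty p ∣p∣>0 with nonempty? p
... | yes nonempty = nonempty
... | no empty = ⊥-elim (ℕ.<-irrefl (sym (Empty⇒∣p∣≡0 empty)) ∣p∣>0)

∣p∣≤length : {n : ℕ} (p : Subset n) (xs : List (Fin n)) →
  (∀ {x} → x ∈ p → x ∈ₗ xs) → ∣ p ∣ ≤ length xs
∣p∣≤length p [] p⊆[] = ℕ.≤-reflexive (Empty⇒∣p∣≡0 λ { (x , x∈p) → ¬Any[] (p⊆[] x∈p) })
∣p∣≤length p (y ∷ ys) p⊆y∷ys =
  ℕ.≤-trans (∣p∣≤1+∣p-x∣ y p) (s≤s (∣p∣≤length (p - y) ys p-y⊆ys))
  where
  p-y⊆ys : ∀ {x} → x ∈ p - y → x ∈ₗ ys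
  p-y⊆ys x∈ with p⊆y∷ys (p─q⊆p p ⁅ y ⁆ x∈)
  ... | here x≡y = ⊥-elim (x∈p-y⇒x≢y p x∈ x≡y)
  ... | there x∈ys = x∈ys

∣p∣≤1⇒≡ : {n : ℕ} {x y : Fin n} (p : Subset n) → ∣ p ∣ ≤ 1 → x ∈ p → y ∈ p → x ≡ y
∣p∣≤1⇒≡ {x = x} {y} p ∣p∣≤1 x∈ y∈ with x ≟ y
... | yes x≡y = x≡y
... | no x≢y = ⊥-elim (ℕ.≤⇒≯ ∣p∣≤1 (subst (1 <_) (sym ∣p∣≡2+) (s≤s (s≤s z≤n))))
  where
  ∣p∣≡2+ : ∣ p ∣ ≡ suc (suc ∣ p - y - x ∣)
  ∣p∣≡2+ = trans (∣p∣≡1+∣p-x∣ p y∈)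
                 (cong suc (∣p∣≡1+∣p-x∣ (p - y) (x∈p∧x≢y⇒x∈p-y x∈ x≢y)))

m∸1≡1+n⇒m≡2+n : ∀ {n} m → m ∸ 1 ≡ suc n → m ≡ suc (suc n)
m∸1≡1+n⇒m≡2+n (suc m) refl = refl

∣p∣∸1≡1+m⇒Nonempty : {n m : ℕ} (p : Subset n) → ∣ p ∣ ∸ 1 ≡ suc m → Nonempty p
∣p∣∸1≡1+m⇒Nonempty p size =
  ∣p∣>0⇒Nonempty p (subst (0 <_) (sym (m∸1≡1+n⇒m≡2+n ∣ p ∣ size)) (s≤s z≤n))

∣p∣∸1≡1+m⇒∣p-x∣∸1≡m : {n m : ℕ} {x : Fin n} (p : Subset n) → x ∈ p →
  ∣ p ∣ ∸ 1 ≡ suc m → ∣ p - x ∣ ∸ 1 ≡ m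
∣p∣∸1≡1+m⇒∣p-x∣∸1≡m p x∈ size =
  cong (_∸ 1) (trans (cong (_∸ 1) (sym (∣p∣≡1+∣p-x∣ p x∈))) size)

p⊆q⇒p∪[q─p]≡q : {n : ℕ} {p q : Subset n} → p ⊆ q → p ∪ (q ─ p) ≡ q
p⊆q⇒p∪[q─p]≡q {p = p} {q} p⊆q = ⊆-antisym
  (λ x∈ → [ p⊆q , p─q⊆p q p ]′ (x∈p∪q⁻ p (q ─ p) x∈))
  (λ {x} x∈q → x∈p∪q⁺ (map₂ (x∈p∧x∉q⇒x∈p─q x∈q) (toSum (x ∈? p))))

HasCount-∈ : {n : ℕ} (p : Subset n) → HasCount (_∈ p) ∣ p ∣
HasCount-∈ [] = [] , [] , (λ ()) , refl
HasCount-∈ (false ∷ p) = HasCount-resp ∈suc⇔ (HasCount-image suc Fin.suc-injective (HasCount-∈ p))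
  where
  ∈suc⇔ : ∀ z → (∃ λ x → x ∈ p × suc x ≡ z) ⇔ z ∈ false ∷ p
  ∈suc⇔ z = mk⇔ (λ { (x , x∈ , refl) → there x∈ }) λ { (there x∈) → _ , x∈ , refl }
HasCount-∈ (true ∷ p) = HasCount-resp ∈zero-suc⇔ (HasCount-insert zero (λ { (_ , _ , ()) })
                          (HasCount-image suc Fin.suc-injective (HasCount-∈ p)))
  where
  ∈zero-suc⇔ : ∀ z → (z ≡ zero ⊎ ∃ λ x → x ∈ p × suc x ≡ z) ⇔ z ∈ true ∷ p
  ∈zero-suc⇔ z = mk⇔ (λ { (inj₁ refl) → here ; (inj₂ (x , x∈ , refl)) → there x∈ })
                     λ { here → inj₁ refl ; (there x∈) → inj₂ (_ , x∈ , refl) }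

Greatest : {n : ℕ} → (Fin n → Set) → Fin n → Set
Greatest P m = P m × (∀ x → P x → x Fin.≤ m)

Greatest-unique : {n : ℕ} {P : Fin n → Set} {m m′ : Fin n} → Greatest P m → Greatest P m′ → m ≡ m′
Greatest-unique (pm , ≤m) (pm′ , ≤m′) = Fin.≤-antisym (≤m′ _ pm) (≤m _ pm′)

argmax : {n : ℕ} {P : Fin n → Set} (f : Fin n → ℕ) → Decidable P →
         (∀ x → ¬ P x) ⊎ ∃ λ m → P m × (∀ x → P x → f x ≤ f m)
argmax {zero} f P? = inj₁ λ ()
argmax {suc n} f P? with argmax (λ x → f (suc x)) (λ x → P? (suc x)) | P? zero
... | inj₁ none | no ¬p0 = inj₁ λ { zero → ¬p0 ; (suc x) → none x }
... | inj₁ none | yes p0 = inj₂ (zero , p0 , λ { zero _ → ℕ.≤-refl ; (suc x) px → ⊥-elim (none x px) })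
... | inj₂ (m , pm , ≤m) | no ¬p0 = inj₂ (suc m , pm , λ { zero p0 → ⊥-elim (¬p0 p0) ; (suc x) px → ≤m x px })
... | inj₂ (m , pm , ≤m) | yes p0 with f zero ℕ.≤? f (suc m)
...   | yes f0≤ = inj₂ (suc m , pm , λ { zero _ → f0≤ ; (suc x) px → ≤m x px })
...   | no f0≰ = inj₂ (zero , p0 , λ { zero _ → ℕ.≤-refl
                                     ; (suc x) px → ℕ.≤-trans (≤m x px) (ℕ.<⇒≤ (ℕ.≰⇒> f0≰)) })

greatest : {n : ℕ} {P : Fin n → Set} → Fin n → Decidable P → Fin n
greatest default P? with argmax toℕ P?
... | inj₁ _ = default
... | inj₂ (m , _) = m

greatest-greatest : {n : ℕ} {P : Fin n → Set} {x : Fin n} (default : Fin n) (P? : Decidable P) →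
  P x → Greatest P (greatest default P?)
greatest-greatest {x = x} default P? px with argmax toℕ P?
... | inj₁ none = ⊥-elim (none x px)
... | inj₂ (m , greatest-m) = greatest-m

greatest-cong : {n : ℕ} {P Q : Fin n → Set} (default : Fin n) (P? : Decidable P) (Q? : Decidable Q) →
  (∀ x → P x ⇔ Q x) → greatest default P? ≡ greatest default Q?
greatest-cong default P? Q? P⇔Q with argmax toℕ P? | argmax toℕ Q?
... | inj₁ _ | inj₁ _ = refl
... | inj₁ noneP | inj₂ (m , qm , _) = ⊥-elim (noneP m (from (P⇔Q m) qm))
... | inj₂ (m , pm , _) | inj₁ noneQ = ⊥-elim (noneQ m (to (P⇔Q m) pm))
... | inj₂ (m , pm , ≤m) | inj₂ (m′ , qm′ , ≤m′) =
  Greatest-unique (pm , ≤m) (from (P⇔Q m′) qm′ , λ x px → ≤m′ x (to (P⇔Q x) px))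

lookup-ext : {X : Set} {k : ℕ} {xs ys : Vec X k} → (∀ i → lookup xs i ≡ lookup ys i) → xs ≡ ys
lookup-ext {xs = xs} {ys} xs≗ys = trans (sym (tabulate∘lookup xs)) (trans (tabulate-cong xs≗ys) (tabulate∘lookup ys))

[]≔-[]≔-lookup : {X : Set} {k : ℕ} (xs : Vec X k) (i : Fin k) {v w : X} →
  lookup xs i ≡ v → (xs [ i ]≔ w) [ i ]≔ v ≡ xs
[]≔-[]≔-lookup xs i refl = trans ([]≔-idempotent xs i) ([]≔-lookup xs i)

Pointwise-graph⇒map≡ : {k : ℕ} {A B : Set} {f : B → A} {P : B → Set} {xs : Vec A k} {ys : Vec B k} →
  Pointwise (λ x y → f y ≡ x × P y) xs ys → Vec.map f ys ≡ xs
Pointwise-graph⇒map≡ [] = refl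
Pointwise-graph⇒map≡ ((fy≡x , _) ∷ rest) = cong₂ _∷_ fy≡x (Pointwise-graph⇒map≡ rest)

map≡⇒Pointwise-graph : {k : ℕ} {A B : Set} {f : B → A} {P : B → Set} {xs : Vec A k} (ys : Vec B k) →
  Vec.map f ys ≡ xs → (∀ i → P (lookup ys i)) → Pointwise (λ x y → f y ≡ x × P y) xs ys
map≡⇒Pointwise-graph [] refl _ = []
map≡⇒Pointwise-graph (y ∷ ys) refl P-ys = (refl , P-ys zero) ∷ map≡⇒Pointwise-graph ys refl (λ i → P-ys (suc i))

-- Rooted trees as parent vectors

Parents : ℕ → Set
Parents n = Vec (Maybe (Fin n)) n

module _ {n : ℕ} where

  variable
    m : ℕ
    A : Subset n
    r ℓ c x y : Fin n
    p q : Parents n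
    ds : List (Fin n)

  Vertex : Subset n → Fin n → Fin n → Set
  Vertex A r x = x ∈ A ⊎ x ≡ r

  record Tree (A : Subset n) (r : Fin n) (p : Parents n) : Set where
    field
      root∉ : r ∉ A
      outside : ∀ i → i ∉ A → lookup p i ≡ nothing
      parent : ∀ i → i ∈ A → ∃ λ j → lookup p i ≡ just j × Vertex A r j
      reaches : ∀ i → i ∈ A → ∃ λ m → climb p m (just i) ≡ just r

  open Tree

  climb-nothing : (p : Parents n) (m : ℕ) → climb p m nothing ≡ nothing
  climb-nothing p zero = refl
  climb-nothing p (suc m) = climb-nothing p m

  climb-fixed : lookup p x ≡ just x → ∀ m → climb p m (just x) ≡ just x
  climb-fixed px≡x zero = refl
  climb-fixed {p = p} px≡x (suc m) rewrite px≡x = climb-fixed {p = p} px≡x m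

  climb-length-unique : lookup p r ≡ nothing → ∀ a b (mx : Maybe (Fin n)) →
    climb p a mx ≡ just r → climb p b mx ≡ just r → a ≡ b
  climb-length-unique pr zero zero mx _ _ = refl
  climb-length-unique {p = p} pr zero (suc b) _ refl climb≡r
    with trans (sym (climb-nothing p b)) (trans (cong (climb p b) (sym pr)) climb≡r)
  ... | ()
  climb-length-unique {p = p} pr (suc a) zero _ climb≡r refl
    with trans (sym (climb-nothing p a)) (trans (cong (climb p a) (sym pr)) climb≡r)
  ... | ()
  climb-length-unique {p = p} pr (suc a) (suc b) nothing climb≡r _
    with trans (sym (climb-nothing p a)) climb≡r
  ... | ()
  climb-length-unique {p = p} pr (suc a) (suc b) (just x) climb≡r climb≡r′ =
    cong suc (climb-length-unique pr a b (lookup p x) climb≡r climb≡r′)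

  climb-update : (C : Fin n → Set) → (∀ {x y} → C x → lookup p x ≡ just y → C y) → ¬ C ℓ →
    ∀ (v : Maybe (Fin n)) m → C x → climb (p [ ℓ ]≔ v) m (just x) ≡ climb p m (just x)
  climb-update C closed ¬Cℓ v zero Cx = refl
  climb-update {p = p} {ℓ = ℓ} {x = x} C closed ¬Cℓ v (suc m) Cx =
    trans (cong (climb (p [ ℓ ]≔ v) m) (lookup∘update′ (λ { refl → ¬Cℓ Cx }) p v)) (step (lookup p x) refl)
    where
    step : ∀ mx → lookup p x ≡ mx → climb (p [ ℓ ]≔ v) m mx ≡ climb p m mx
    step nothing _ = trans (climb-nothing (p [ ℓ ]≔ v) m) (sym (climb-nothing p m))
    step (just y) px = climb-update C closed ¬Cℓ v m (closed Cx px)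

  Vertex-⊆ : Vertex (A - ℓ) r x → Vertex A r x
  Vertex-⊆ {A = A} {ℓ = ℓ} (inj₁ x∈) = inj₁ (p─q⊆p A ⁅ ℓ ⁆ x∈)
  Vertex-⊆ (inj₂ x≡r) = inj₂ x≡r

  Vertex-remove : Vertex A r x → x ≢ ℓ → Vertex (A - ℓ) r x
  Vertex-remove (inj₁ x∈) x≢ℓ = inj₁ (x∈p∧x≢y⇒x∈p-y x∈ x≢ℓ)
  Vertex-remove (inj₂ x≡r) _ = inj₂ x≡r

  removed-not-Vertex : r ∉ A → ℓ ∈ A → ¬ Vertex (A - ℓ) r ℓ
  removed-not-Vertex {A = A} r∉A ℓ∈A (inj₁ ℓ∈) = x∈p-y⇒x≢y A ℓ∈ refl
  removed-not-Vertex r∉A ℓ∈A (inj₂ refl) = r∉A ℓ∈A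

  parent-closed : Tree A r p → Vertex A r x → lookup p x ≡ just y → Vertex A r y
  parent-closed T (inj₁ x∈) px≡y with parent T _ x∈
  ... | j , px≡j , Vj rewrite Maybe.just-injective (trans (sym px≡j) px≡y) = Vj
  parent-closed T (inj₂ refl) px≡y with trans (sym px≡y) (outside T _ (root∉ T))
  ... | ()

  no-selfloop : Tree A r p → x ∈ A → lookup p x ≡ just y → x ≢ y
  no-selfloop {A = A} {r = r} {p = p} {x = x} T x∈ px≡x refl with reaches T x x∈
  ... | m , climb≡r = root∉ T (subst (_∈ A) x≡r x∈)
    where
    x≡r : x ≡ r
    x≡r = Maybe.just-injective (trans (sym (climb-fixed {p = p} px≡x m)) climb≡r)

  IsLeaf : Subset n → Parents n → Fin n → Set
  IsLeaf A p x = x ∈ A × (∀ y → y ∈ A → lookup p y ≢ just x)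

  isLeaf? : (A : Subset n) (p : Parents n) → Decidable (IsLeaf A p)
  isLeaf? A p x = x ∈? A ×-dec Fin.all? λ y → y ∈? A →-dec ¬? (Maybe.≡-dec _≟_ (lookup p y) (just x))

  depth : Tree A r p → Fin n → ℕ
  depth {A = A} T x with x ∈? A
  ... | yes x∈ = proj₁ (reaches T x x∈)
  ... | no _ = 0

  climb-depth : (T : Tree A r p) → x ∈ A → climb p (depth T x) (just x) ≡ just r
  climb-depth {A = A} {x = x} T x∈ with x ∈? A
  ... | yes x∈′ = proj₂ (reaches T x x∈′)
  ... | no x∉ = ⊥-elim (x∉ x∈)

  leaf-exists : Tree A r p → x ∈ A → ∃ (IsLeaf A p)
  leaf-exists {A = A} {p = p} {x = x} T x∈ with argmax (depth T) (_∈? A)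
  ... | inj₁ none = ⊥-elim (none x x∈)
  ... | inj₂ (z , z∈ , deepest) = z , z∈ , λ y y∈ py≡z →
    ℕ.<-irrefl refl (subst (_≤ depth T z) (depth-child y∈ py≡z) (deepest y y∈))
    where
    depth-child : y ∈ A → lookup p y ≡ just z → depth T y ≡ suc (depth T z)
    depth-child {y = y} y∈ py≡z =
      climb-length-unique (outside T _ (root∉ T)) (depth T y) (suc (depth T z)) (just y) (climb-depth T y∈)
        (trans (cong (climb p (depth T z)) py≡z) (climb-depth T z∈))

  prune : Tree A r p → IsLeaf A p ℓ → Tree (A - ℓ) r (p [ ℓ ]≔ nothing)
  prune {A = A} {r = r} {p = p} {ℓ = ℓ} T (ℓ∈A , childless) = record
    { root∉ = λ r∈ → root∉ T (p─q⊆p A ⁅ ℓ ⁆ r∈)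
    ; outside = outside′
    ; parent = λ i i∈ → let j , pi≡j , Vj = parent T i (p─q⊆p A ⁅ ℓ ⁆ i∈) in
        j , trans (lookup∘update′ (x∈p-y⇒x≢y A i∈) p nothing) pi≡j , closed (inj₁ i∈) pi≡j
    ; reaches = λ i i∈ → let m , climb≡r = reaches T i (p─q⊆p A ⁅ ℓ ⁆ i∈) in
        m , trans (climb-update (Vertex (A - ℓ) r) closed (removed-not-Vertex (root∉ T) ℓ∈A) nothing m (inj₁ i∈))
                  climb≡r
    }
    where
    closed : Vertex (A - ℓ) r x → lookup p x ≡ just y → Vertex (A - ℓ) r y
    closed Vx px≡y = Vertex-remove (parent-closed T (Vertex-⊆ Vx) px≡y) λ { refl → ℓ-childless Vx px≡y }
      where
      ℓ-childless : Vertex (A - ℓ) r x → lookup p x ≢ just ℓ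
      ℓ-childless (inj₁ x∈) = childless _ (p─q⊆p A ⁅ ℓ ⁆ x∈)
      ℓ-childless (inj₂ refl) pr≡ℓ with trans (sym pr≡ℓ) (outside T r (root∉ T))
      ... | ()
    outside′ : ∀ i → i ∉ A - ℓ → lookup (p [ ℓ ]≔ nothing) i ≡ nothing
    outside′ i i∉ with i ≟ ℓ
    ... | yes refl = lookup∘update ℓ p nothing
    ... | no i≢ℓ =
      trans (lookup∘update′ i≢ℓ p nothing) (outside T i λ i∈ → i∉ (x∈p∧x≢y⇒x∈p-y i∈ i≢ℓ))

  graft : Tree (A - ℓ) r q → r ∉ A → ℓ ∈ A → Vertex (A - ℓ) r c → Tree A r (q [ ℓ ]≔ just c)
  graft {A = A} {ℓ = ℓ} {r = r} {q = q} {c = c} T r∉A ℓ∈A Vc = record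
    { root∉ = r∉A
    ; outside = λ i i∉ → trans (lookup∘update′ (λ { refl → i∉ ℓ∈A }) q (just c))
                               (outside T i λ i∈ → i∉ (p─q⊆p A ⁅ ℓ ⁆ i∈))
    ; parent = parent′
    ; reaches = reaches′
    }
    where
    reaches-Vertex : Vertex (A - ℓ) r x → ∃ λ m → climb (q [ ℓ ]≔ just c) m (just x) ≡ just r
    reaches-Vertex (inj₂ refl) = 0 , refl
    reaches-Vertex {x} (inj₁ x∈) = let m , climb≡r = reaches T x x∈ in
      m , trans (climb-update (Vertex (A - ℓ) r) (parent-closed T) (removed-not-Vertex r∉A ℓ∈A) (just c) m (inj₁ x∈))
                climb≡r
    parent′ : ∀ i → i ∈ A → ∃ λ j → lookup (q [ ℓ ]≔ just c) i ≡ just j × Vertex A r j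
    parent′ i i∈ with i ≟ ℓ
    ... | yes refl = c , lookup∘update ℓ q (just c) , Vertex-⊆ Vc
    ... | no i≢ℓ = let j , qi≡j , Vj = parent T i (x∈p∧x≢y⇒x∈p-y i∈ i≢ℓ) in
      j , trans (lookup∘update′ i≢ℓ q (just c)) qi≡j , Vertex-⊆ Vj
    reaches′ : ∀ i → i ∈ A → ∃ λ m → climb (q [ ℓ ]≔ just c) m (just i) ≡ just r
    reaches′ i i∈ with i ≟ ℓ
    ... | yes refl = let m , climb≡r = reaches-Vertex Vc in
      suc m , trans (cong (climb (q [ ℓ ]≔ just c) m) (lookup∘update ℓ q (just c))) climb≡r
    ... | no i≢ℓ = reaches-Vertex (inj₁ (x∈p∧x≢y⇒x∈p-y i∈ i≢ℓ))

  -- With fresh-cons, this is why the leaves of a tree are exactly the vertices of A absent from its code.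
  graft-leaf : Tree (A - ℓ) r q → r ∉ A → ℓ ∈ A → Vertex (A - ℓ) r c →
    IsLeaf A (q [ ℓ ]≔ just c) x ⇔ (x ≡ ℓ ⊎ IsLeaf (A - ℓ) q x × x ≢ c)
  graft-leaf {A = A} {ℓ = ℓ} {r = r} {q = q} {c = c} {x = x} T r∉A ℓ∈A Vc = mk⇔ to′ from′
    where
    q′ : Parents n
    q′ = q [ ℓ ]≔ just c
    lookup-ℓ : lookup q′ ℓ ≡ just c
    lookup-ℓ = lookup∘update ℓ q (just c)
    lookup-≢ℓ : y ≢ ℓ → lookup q′ y ≡ lookup q y
    lookup-≢ℓ y≢ℓ = lookup∘update′ y≢ℓ q (just c)
    to′ : IsLeaf A q′ x → x ≡ ℓ ⊎ IsLeaf (A - ℓ) q x × x ≢ c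
    to′ (x∈ , childless) with x ≟ ℓ
    ... | yes x≡ℓ = inj₁ x≡ℓ
    ... | no x≢ℓ = inj₂ ((x∈p∧x≢y⇒x∈p-y x∈ x≢ℓ ,
                          λ y y∈ qy≡x → childless y (p─q⊆p A ⁅ ℓ ⁆ y∈) (trans (lookup-≢ℓ (x∈p-y⇒x≢y A y∈)) qy≡x)) ,
                         λ { refl → childless ℓ ℓ∈A lookup-ℓ })
    from′ : x ≡ ℓ ⊎ IsLeaf (A - ℓ) q x × x ≢ c → IsLeaf A q′ x
    from′ (inj₁ refl) = ℓ∈A , ℓ-childless
      where
      ℓ-childless : ∀ y → y ∈ A → lookup q′ y ≢ just ℓ
      ℓ-childless y y∈ q′y≡ℓ with y ≟ ℓ
      ... | yes refl =
        removed-not-Vertex r∉A ℓ∈A (subst (Vertex (A - ℓ) r) (Maybe.just-injective (trans (sym lookup-ℓ) q′y≡ℓ)) Vc)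
      ... | no y≢ℓ = removed-not-Vertex r∉A ℓ∈A
                       (parent-closed T (inj₁ (x∈p∧x≢y⇒x∈p-y y∈ y≢ℓ)) (trans (sym (lookup-≢ℓ y≢ℓ)) q′y≡ℓ))
    from′ (inj₂ ((x∈ , childless) , x≢c)) = p─q⊆p A ⁅ ℓ ⁆ x∈ , x-childless
      where
      x-childless : ∀ y → y ∈ A → lookup q′ y ≢ just x
      x-childless y y∈ q′y≡x with y ≟ ℓ
      ... | yes refl = x≢c (Maybe.just-injective (trans (sym q′y≡x) lookup-ℓ))
      ... | no y≢ℓ = childless y (x∈p∧x≢y⇒x∈p-y y∈ y≢ℓ) (trans (sym (lookup-≢ℓ y≢ℓ)) q′y≡x)

  -- Prüfer codes

  Fresh : Subset n → List (Fin n) → Fin n → Set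
  Fresh A ds x = x ∈ A × x ∉ₗ ds

  fresh? : (A : Subset n) (ds : List (Fin n)) → Decidable (Fresh A ds)
  fresh? A ds x = x ∈? A ×-dec ¬? (DecMembership._∈?_ _≟_ x ds)

  fresh-exists : length ds < ∣ A ∣ → ∃ (Fresh A ds)
  fresh-exists {ds = ds} {A = A} len< with Fin.any? (fresh? A ds)
  ... | yes fresh = fresh
  ... | no none = ⊥-elim (ℕ.<⇒≱ len< (∣p∣≤length A ds A⊆ds))
    where
    A⊆ds : ∀ {x} → x ∈ A → x ∈ₗ ds
    A⊆ds {x} x∈ with DecMembership._∈?_ _≟_ x ds
    ... | yes x∈ds = x∈ds
    ... | no x∉ds = ⊥-elim (none (x , x∈ , x∉ds))

  fresh-cons : ℓ ∈ A → ℓ ∉ₗ c ∷ ds → Fresh A (c ∷ ds) x ⇔ (x ≡ ℓ ⊎ Fresh (A - ℓ) ds x × x ≢ c)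
  fresh-cons {ℓ = ℓ} {A = A} {c = c} {ds = ds} {x = x} ℓ∈A ℓ∉ = mk⇔ to′ from′
    where
    to′ : Fresh A (c ∷ ds) x → x ≡ ℓ ⊎ Fresh (A - ℓ) ds x × x ≢ c
    to′ (x∈ , x∉) with x ≟ ℓ
    ... | yes x≡ℓ = inj₁ x≡ℓ
    ... | no x≢ℓ = inj₂ ((x∈p∧x≢y⇒x∈p-y x∈ x≢ℓ , x∉ ∘ there) , x∉ ∘ here)
    from′ : x ≡ ℓ ⊎ Fresh (A - ℓ) ds x × x ≢ c → Fresh A (c ∷ ds) x
    from′ (inj₁ refl) = ℓ∈A , ℓ∉
    from′ (inj₂ ((x∈ , x∉) , x≢c)) =
      p─q⊆p A ⁅ ℓ ⁆ x∈ , λ { (here x≡c) → x≢c x≡c ; (there x∈ds) → x∉ x∈ds }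

  maxLeaf : Subset n → Fin n → Parents n → Fin n
  maxLeaf A r p = greatest r (isLeaf? A p)

  maxFresh : Subset n → Fin n → List (Fin n) → Fin n
  maxFresh A r ds = greatest r (fresh? A ds)

  encode : ℕ → Subset n → Fin n → Parents n → List (Fin n)
  encode zero A r p = []
  encode (suc m) A r p = fromMaybe r (lookup p leaf) ∷ encode m (A - leaf) r (p [ leaf ]≔ nothing)
    where
    leaf : Fin n
    leaf = maxLeaf A r p

  star : Subset n → Fin n → Parents n
  star A r = tabulate λ i → if does (i ∈? A) then just r else nothing

  decode : Subset n → Fin n → List (Fin n) → Parents n
  decode A r [] = star A r
  decode A r (c ∷ ds) = decode (A - leaf) r ds [ leaf ]≔ just c
    where
    leaf : Fin n
    leaf = maxFresh A r (c ∷ ds)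

  lookup-star : (A : Subset n) (r x : Fin n) → lookup (star A r) x ≡ (if does (x ∈? A) then just r else nothing)
  lookup-star A r = lookup∘tabulate _

  lookup-star-∈ : x ∈ A → lookup (star A r) x ≡ just r
  lookup-star-∈ {x = x} {A = A} {r = r} x∈ rewrite lookup-star A r x with x ∈? A
  ... | yes _ = refl
  ... | no x∉ = ⊥-elim (x∉ x∈)

  lookup-star-∉ : x ∉ A → lookup (star A r) x ≡ nothing
  lookup-star-∉ {x = x} {A = A} {r = r} x∉ rewrite lookup-star A r x with x ∈? A
  ... | yes x∈ = ⊥-elim (x∉ x∈)
  ... | no _ = refl

  star-tree : r ∉ A → Tree A r (star A r)
  star-tree r∉A = record
    { root∉ = r∉A
    ; outside = λ i → lookup-star-∉
    ; parent = λ i i∈ → _ , lookup-star-∈ i∈ , inj₂ refl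
    ; reaches = λ i i∈ → 1 , lookup-star-∈ i∈
    }

  star-leaf : r ∉ A → IsLeaf A (star A r) x ⇔ Fresh A [] x
  star-leaf {r = r} {A = A} {x = x} r∉A = mk⇔ (λ (x∈ , _) → x∈ , λ ()) λ (x∈ , _) → x∈ , childless x∈
    where
    childless : x ∈ A → ∀ y → y ∈ A → lookup (star A r) y ≢ just x
    childless x∈ y y∈ star-y≡x =
      r∉A (subst (_∈ A) (sym (Maybe.just-injective (trans (sym (lookup-star-∈ y∈)) star-y≡x))) x∈)

  star-unique : Tree A r p → ∣ A ∣ ≤ 1 → star A r ≡ p
  star-unique {A = A} {r = r} {p = p} T ∣A∣≤1 = lookup-ext star≗p
    where
    star≗p : ∀ i → lookup (star A r) i ≡ lookup p i
    star≗p i with i ∈? A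
    ... | no i∉ = trans (lookup-star-∉ i∉) (sym (outside T i i∉))
    ... | yes i∈ with parent T i i∈
    ...   | j , pi≡j , inj₂ refl = trans (lookup-star-∈ i∈) (sym pi≡j)
    ...   | j , pi≡j , inj₁ j∈ = ⊥-elim (no-selfloop T i∈ pi≡j (∣p∣≤1⇒≡ A ∣A∣≤1 i∈ j∈))

  encode-length : ∀ m → length (encode m A r p) ≡ m
  encode-length zero = refl
  encode-length (suc m) = cong suc (encode-length m)

  module EncodeStep (T : Tree A r p) (size : ∣ A ∣ ∸ 1 ≡ suc m) where

    ℓ₀ : Fin n
    ℓ₀ = maxLeaf A r p

    ℓ₀-leaf : IsLeaf A p ℓ₀
    ℓ₀-leaf = let x , x∈ = ∣p∣∸1≡1+m⇒Nonempty A size in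
      proj₁ (greatest-greatest r (isLeaf? A p) (proj₂ (leaf-exists T x∈)))

    ℓ₀∈A : ℓ₀ ∈ A
    ℓ₀∈A = proj₁ ℓ₀-leaf

    c₀ : Fin n
    c₀ = fromMaybe r (lookup p ℓ₀)

    p₀ : Parents n
    p₀ = p [ ℓ₀ ]≔ nothing

    T₀ : Tree (A - ℓ₀) r p₀
    T₀ = prune T ℓ₀-leaf

    size₀ : ∣ A - ℓ₀ ∣ ∸ 1 ≡ m
    size₀ = ∣p∣∸1≡1+m⇒∣p-x∣∸1≡m A ℓ₀∈A size

    lookup-ℓ₀ : lookup p ℓ₀ ≡ just c₀
    lookup-ℓ₀ with parent T ℓ₀ ℓ₀∈A
    ... | j , pℓ₀≡j , _ = trans pℓ₀≡j (cong (just ∘ fromMaybe r) (sym pℓ₀≡j))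

    c₀-Vertex : Vertex (A - ℓ₀) r c₀
    c₀-Vertex = Vertex-remove (parent-closed T (inj₁ ℓ₀∈A) lookup-ℓ₀) (no-selfloop T ℓ₀∈A lookup-ℓ₀ ∘ sym)

    p≡graft : p₀ [ ℓ₀ ]≔ just c₀ ≡ p
    p≡graft = []≔-[]≔-lookup p ℓ₀ lookup-ℓ₀

  encode-vertices : Tree A r p → ∣ A ∣ ∸ 1 ≡ m → All (Vertex A r) (encode m A r p)
  encode-vertices {m = zero} T size = []
  encode-vertices {m = suc m} T size = All.map Vertex-⊆ (c₀-Vertex ∷ encode-vertices T₀ size₀)
    where open EncodeStep T size

  encode-leaf : Tree A r p → ∣ A ∣ ∸ 1 ≡ m → IsLeaf A p x ⇔ Fresh A (encode m A r p) x
  encode-leaf {A = A} {p = p} {m = zero} T size =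
    mk⇔ (λ (x∈ , _) → x∈ , λ ()) λ (x∈ , _) → x∈ , λ y y∈ py≡x →
      no-selfloop T y∈ py≡x (∣p∣≤1⇒≡ A (ℕ.m∸n≡0⇒m≤n size) y∈ x∈)
  encode-leaf {A = A} {r = r} {p = p} {m = suc m} {x = x} T size = begin
    IsLeaf A p x                                                  ≡⟨ cong (λ p′ → IsLeaf A p′ x) (sym p≡graft) ⟩
    IsLeaf A (p₀ [ ℓ₀ ]≔ just c₀) x                               ∼⟨ graft-leaf T₀ (root∉ T) ℓ₀∈A c₀-Vertex ⟩
    (x ≡ ℓ₀ ⊎ IsLeaf (A - ℓ₀) p₀ x × x ≢ c₀)                      ∼⟨ ⇔.refl ⊎-⇔ (encode-leaf T₀ size₀ ×-⇔ ⇔.refl) ⟩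
    (x ≡ ℓ₀ ⊎ Fresh (A - ℓ₀) (encode m (A - ℓ₀) r p₀) x × x ≢ c₀) ∼⟨ ⇔.sym (fresh-cons ℓ₀∈A ℓ₀∉code) ⟩
    Fresh A (encode (suc m) A r p) x                              ∎
    where
    open EncodeStep T size
    open EquationalReasoning
    ℓ₀∉code : ℓ₀ ∉ₗ encode (suc m) A r p
    ℓ₀∉code ℓ₀∈ =
      removed-not-Vertex (root∉ T) ℓ₀∈A (All.lookup (c₀-Vertex ∷ encode-vertices T₀ size₀) ℓ₀∈)

  decode-encode : Tree A r p → ∣ A ∣ ∸ 1 ≡ m → decode A r (encode m A r p) ≡ p
  decode-encode {m = zero} T size = star-unique T (ℕ.m∸n≡0⇒m≤n size)
  decode-encode {A = A} {r = r} {p = p} {m = suc m} T size = begin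
    decode (A - ℓ′) r code₀ [ ℓ′ ]≔ just c₀ ≡⟨ cong (λ ℓ → decode (A - ℓ) r code₀ [ ℓ ]≔ just c₀) maxFresh≡ℓ₀ ⟩
    decode (A - ℓ₀) r code₀ [ ℓ₀ ]≔ just c₀ ≡⟨ cong (_[ ℓ₀ ]≔ just c₀) (decode-encode T₀ size₀) ⟩
    p₀ [ ℓ₀ ]≔ just c₀                     ≡⟨ p≡graft ⟩
    p                                       ∎
    where
    open EncodeStep T size
    open ≡-Reasoning
    code₀ : List (Fin n)
    code₀ = encode m (A - ℓ₀) r p₀
    ℓ′ : Fin n
    ℓ′ = maxFresh A r (c₀ ∷ code₀)
    maxFresh≡ℓ₀ : ℓ′ ≡ ℓ₀
    maxFresh≡ℓ₀ = greatest-cong r (fresh? A (c₀ ∷ code₀)) (isLeaf? A p) λ _ → ⇔.sym (encode-leaf T size)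

  Code : Subset n → Fin n → List (Fin n) → Set
  Code A r ds = length ds ≡ ∣ A ∣ ∸ 1 × All (Vertex A r) ds

  All-Vertex-remove : ℓ ∉ₗ ds → All (Vertex A r) ds → All (Vertex (A - ℓ) r) ds
  All-Vertex-remove ℓ∉ [] = []
  All-Vertex-remove ℓ∉ (v ∷ vs) =
    Vertex-remove v (λ { refl → ℓ∉ (here refl) }) ∷ All-Vertex-remove (ℓ∉ ∘ there) vs

  module DecodeStep (r∉A : r ∉ A) (code : Code A r (c ∷ ds)) where

    ℓ₁ : Fin n
    ℓ₁ = maxFresh A r (c ∷ ds)

    ℓ₁-fresh : Fresh A (c ∷ ds) ℓ₁
    ℓ₁-fresh = proj₁ (greatest-greatest r (fresh? A (c ∷ ds)) (proj₂ (fresh-exists code<∣A∣)))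
      where
      code<∣A∣ : length (c ∷ ds) < ∣ A ∣
      code<∣A∣ rewrite m∸1≡1+n⇒m≡2+n ∣ A ∣ (sym (proj₁ code)) = ℕ.≤-refl

    ℓ₁∈A : ℓ₁ ∈ A
    ℓ₁∈A = proj₁ ℓ₁-fresh

    r∉A₁ : r ∉ A - ℓ₁
    r∉A₁ r∈ = r∉A (p─q⊆p A ⁅ ℓ₁ ⁆ r∈)

    vertices₁ : All (Vertex (A - ℓ₁) r) (c ∷ ds)
    vertices₁ = All-Vertex-remove (proj₂ ℓ₁-fresh) (proj₂ code)

    code₁ : Code (A - ℓ₁) r ds
    code₁ = sym (∣p∣∸1≡1+m⇒∣p-x∣∸1≡m A ℓ₁∈A (sym (proj₁ code))) , All.tail vertices₁

  decode-tree : r ∉ A → Code A r ds → Tree A r (decode A r ds)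
  decode-tree {ds = []} r∉A code = star-tree r∉A
  decode-tree {ds = c ∷ ds} r∉A code = graft (decode-tree r∉A₁ code₁) r∉A ℓ₁∈A (All.head vertices₁)
    where open DecodeStep r∉A code

  decode-leaf : r ∉ A → Code A r ds → IsLeaf A (decode A r ds) x ⇔ Fresh A ds x
  decode-leaf {ds = []} r∉A code = star-leaf r∉A
  decode-leaf {r = r} {A = A} {ds = c ∷ ds} {x = x} r∉A code = begin
    IsLeaf A (decode (A - ℓ₁) r ds [ ℓ₁ ]≔ just c) x  ∼⟨ graft-leaf (decode-tree r∉A₁ code₁) r∉A ℓ₁∈A (All.head vertices₁) ⟩
    (x ≡ ℓ₁ ⊎ IsLeaf (A - ℓ₁) (decode (A - ℓ₁) r ds) x × x ≢ c)
                                                      ∼⟨ ⇔.refl ⊎-⇔ (decode-leaf r∉A₁ code₁ ×-⇔ ⇔.refl) ⟩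
    (x ≡ ℓ₁ ⊎ Fresh (A - ℓ₁) ds x × x ≢ c)            ∼⟨ ⇔.sym (fresh-cons ℓ₁∈A (proj₂ ℓ₁-fresh)) ⟩
    Fresh A (c ∷ ds) x                                ∎
    where
    open DecodeStep r∉A code
    open EquationalReasoning

  encode-decode : r ∉ A → Code A r ds → encode (length ds) A r (decode A r ds) ≡ ds
  encode-decode {ds = []} r∉A code = refl
  encode-decode {r = r} {A = A} {ds = c ∷ ds} r∉A code = begin
    fromMaybe r (lookup p₁ ℓ′) ∷ encode (length ds) (A - ℓ′) r (p₁ [ ℓ′ ]≔ nothing)
      ≡⟨ cong (λ ℓ → fromMaybe r (lookup p₁ ℓ) ∷ encode (length ds) (A - ℓ) r (p₁ [ ℓ ]≔ nothing)) maxLeaf≡ℓ₁ ⟩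
    fromMaybe r (lookup p₁ ℓ₁) ∷ encode (length ds) (A - ℓ₁) r (p₁ [ ℓ₁ ]≔ nothing)
      ≡⟨ cong₂ (λ c′ q′ → c′ ∷ encode (length ds) (A - ℓ₁) r q′)
               (cong (fromMaybe r) (lookup∘update ℓ₁ q₁ (just c)))
               ([]≔-[]≔-lookup q₁ ℓ₁ (outside (decode-tree r∉A₁ code₁) ℓ₁ λ ℓ₁∈ → x∈p-y⇒x≢y A ℓ₁∈ refl)) ⟩
    c ∷ encode (length ds) (A - ℓ₁) r q₁
      ≡⟨ cong (c ∷_) (encode-decode r∉A₁ code₁) ⟩
    c ∷ ds ∎
    where
    open DecodeStep r∉A code
    open ≡-Reasoning
    q₁ p₁ : Parents n
    q₁ = decode (A - ℓ₁) r ds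
    p₁ = q₁ [ ℓ₁ ]≔ just c
    ℓ′ : Fin n
    ℓ′ = maxLeaf A r p₁
    maxLeaf≡ℓ₁ : ℓ′ ≡ ℓ₁
    maxLeaf≡ℓ₁ = greatest-cong r (isLeaf? A p₁) (fresh? A (c ∷ ds)) λ _ → decode-leaf r∉A code

  HasCount-Vertex : r ∉ A → HasCount (Vertex A r) (suc ∣ A ∣)
  HasCount-Vertex {r = r} {A = A} r∉A =
    HasCount-resp (λ _ → mk⇔ swap swap) (HasCount-insert r r∉A (HasCount-∈ A))

  -- For A = ∅ the exponent ∣ A ∣ ∸ 1 truncates to 0, which is the paper's reading 1^(-1) = 1.
  HasCount-Tree : r ∉ A → HasCount (Tree A r) (suc ∣ A ∣ ^ (∣ A ∣ ∸ 1))
  HasCount-Tree {r = r} {A = A} r∉A =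
    HasCount-bijection (encode (∣ A ∣ ∸ 1) A r) (decode A r)
      (λ p T → encode-length (∣ A ∣ ∸ 1) , encode-vertices T refl)
      (λ ds code → decode-tree r∉A code)
      (λ p T → decode-encode T refl)
      (λ ds code → subst (λ m → encode m A r (decode A r ds) ≡ ds) (proj₁ code) (encode-decode r∉A code))
      (HasCount-lists (HasCount-Vertex r∉A) (∣ A ∣ ∸ 1))

  -- Bonsais

  rooted⇒Tree : {L : Subset n} {p : Parents n} {r : Fin n} → IsRootedTree (L , p) r → Tree (L - r) r p
  rooted⇒Tree {L} {p} {r} (r∈L , pr , outside′ , parent′ , reaches′) = record
    { root∉ = λ r∈ → x∈p-y⇒x≢y L r∈ refl
    ; outside = outside-L
    ; parent = λ i i∈ → let j , pi≡j , j∈L = parent′ i (p─q⊆p L ⁅ r ⁆ i∈) (x∈p-y⇒x≢y L i∈) in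
        j , pi≡j , Vertex-remove-root j∈L
    ; reaches = λ i i∈ → reaches′ i (p─q⊆p L ⁅ r ⁆ i∈)
    }
    where
    outside-L : ∀ i → i ∉ L - r → lookup p i ≡ nothing
    outside-L i i∉ with i ≟ r
    ... | yes refl = pr
    ... | no i≢r = outside′ i λ i∈ → i∉ (x∈p∧x≢y⇒x∈p-y i∈ i≢r)
    Vertex-remove-root : {j : Fin n} → j ∈ L → Vertex (L - r) r j
    Vertex-remove-root {j} j∈ with j ≟ r
    ... | yes j≡r = inj₂ j≡r
    ... | no j≢r = inj₁ (x∈p∧x≢y⇒x∈p-y j∈ j≢r)

  Tree⇒rooted : {L : Subset n} {p : Parents n} {r : Fin n} → r ∈ L → Tree (L - r) r p → IsRootedTree (L , p) r
  Tree⇒rooted {L} {p} {r} r∈L T =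
    r∈L ,
    outside T r (root∉ T) ,
    (λ i i∉ → outside T i λ i∈ → i∉ (p─q⊆p L ⁅ r ⁆ i∈)) ,
    (λ i i∈ i≢r → let j , pi≡j , Vj = parent T i (x∈p∧x≢y⇒x∈p-y i∈ i≢r) in j , pi≡j , Vertex-∈ Vj) ,
    reaches-L
    where
    Vertex-∈ : {j : Fin n} → Vertex (L - r) r j → j ∈ L
    Vertex-∈ (inj₁ j∈) = p─q⊆p L ⁅ r ⁆ j∈
    Vertex-∈ (inj₂ refl) = r∈L
    reaches-L : ∀ i → i ∈ L → ∃ λ m → climb p m (just i) ≡ just r
    reaches-L i i∈ with i ≟ r
    ... | yes i≡r = 0 , cong just i≡r
    ... | no i≢r = reaches T i (x∈p∧x≢y⇒x∈p-y i∈ i≢r)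

  root-unique : {B : BonsaiData n} {r r′ : Fin n} → IsRootedTree B r → IsRootedTree B r′ → r ≡ r′
  root-unique {B = L , p} {r} {r′} (r∈L , pr , _) (_ , _ , _ , _ , reaches′) with reaches′ r r∈L
  ... | zero , r≡r′ = Maybe.just-injective r≡r′
  ... | suc m , climb≡r′ with trans (sym (trans (cong (climb p m) pr) (climb-nothing p m))) climb≡r′
  ...   | ()

  HasCount-bonsai : (L : Subset n) {m : Fin n} → IsMaxOf m L →
    HasCount (λ (B : BonsaiData n) → labels B ≡ L × IsBonsai B) (∣ L ∣ ^ (∣ L ∣ ∸ 2))
  HasCount-bonsai L {m} max-m =
    subst (HasCount _) (cong (λ t → t ^ (t ∸ 2)) (sym (∣p∣≡1+∣p-x∣ L (proj₁ max-m))))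
      (HasCount-bijection parentVec (L ,_)
        (λ { (_ , p) (refl , r , rooted , max-r) →
               rooted⇒Tree (subst (IsRootedTree (L , p)) (Greatest-unique max-r max-m) rooted) })
        (λ p T → refl , m , Tree⇒rooted (proj₁ max-m) T , max-m)
        (λ { (_ , p) (refl , _) → refl })
        (λ p _ → refl)
        (HasCount-Tree λ m∈ → x∈p-y⇒x≢y L m∈ refl))

  -- Restricted flags

  blocks : {k : ℕ} → Vec (Subset n) (suc k) → Vec (Subset n) k
  blocks (_ ∷ []) = []
  blocks (a ∷ b ∷ F) = (b ─ a) ∷ blocks (b ∷ F)

  flagType≡map-∣blocks∣ : {k : ℕ} (F : Vec (Subset n) (suc k)) → flagType F ≡ Vec.map ∣_∣ (blocks F)
  flagType≡map-∣blocks∣ (_ ∷ []) = refl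
  flagType≡map-∣blocks∣ (a ∷ b ∷ F) = cong (∣ b ─ a ∣ ∷_) (flagType≡map-∣blocks∣ (b ∷ F))

  lookup-blocks : {k : ℕ} (F : Vec (Subset n) (suc k)) (j : Fin k) →
    lookup (blocks F) j ≡ lookup F (suc j) ─ lookup F (inject₁ j)
  lookup-blocks (a ∷ b ∷ F) zero = refl
  lookup-blocks (a ∷ b ∷ F) (suc j) = lookup-blocks (b ∷ F) j

  map-∪-prefixUnions-blocks : {k : ℕ} (F : Vec (Subset n) (suc k)) → IsChain F →
    Vec.map (head F ∪_) (prefixUnions (blocks F)) ≡ F
  map-∪-prefixUnions-blocks (a ∷ []) _ = cong (_∷ []) (∪-identityʳ a)
  map-∪-prefixUnions-blocks {suc k} (a ∷ b ∷ F) (a⊆b , chain) = cong₂ _∷_ (∪-identityʳ a) (begin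
    Vec.map (a ∪_) (Vec.map ((b ─ a) ∪_) U)  ≡⟨ map-∘ (a ∪_) ((b ─ a) ∪_) U ⟨
    Vec.map (λ x → a ∪ ((b ─ a) ∪ x)) U      ≡⟨ map-cong (λ x → ∪-assoc a (b ─ a) x) U ⟨
    Vec.map ((a ∪ (b ─ a)) ∪_) U             ≡⟨ cong (λ c → Vec.map (c ∪_) U) (p⊆q⇒p∪[q─p]≡q a⊆b) ⟩
    Vec.map (b ∪_) U                         ≡⟨ map-∪-prefixUnions-blocks (b ∷ F) chain ⟩
    b ∷ F                                    ∎)
    where
    open ≡-Reasoning
    U : Vec (Subset n) (suc k)
    U = prefixUnions (blocks (b ∷ F))

  prefixUnions-blocks : {k : ℕ} (F : Vec (Subset n) (suc k)) → head F ≡ ⊥ → IsChain F → prefixUnions (blocks F) ≡ F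
  prefixUnions-blocks {k} F head≡⊥ chain = begin
    U                        ≡⟨ map-id U ⟨
    Vec.map (λ x → x) U      ≡⟨ map-cong (λ x → trans (sym (∪-identityˡ x)) (cong (_∪ x) (sym head≡⊥))) U ⟩
    Vec.map (head F ∪_) U    ≡⟨ map-∪-prefixUnions-blocks F chain ⟩
    F                        ∎
    where
    open ≡-Reasoning
    U : Vec (Subset n) (suc k)
    U = prefixUnions (blocks F)

  ∈-prefixUnions⁻ : {k : ℕ} {x : Fin n} (Ls : Vec (Subset n) k) (i : Fin (suc k)) →
    x ∈ lookup (prefixUnions Ls) i → ∃ λ j → toℕ j < toℕ i × x ∈ lookup Ls j
  ∈-prefixUnions⁻ [] zero x∈ = ⊥-elim (∉⊥ x∈)
  ∈-prefixUnions⁻ (L ∷ Ls) zero x∈ = ⊥-elim (∉⊥ x∈)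
  ∈-prefixUnions⁻ {x = x} (L ∷ Ls) (suc i) x∈
    with x∈p∪q⁻ L _ (subst (x ∈_) (lookup-map i (L ∪_) (prefixUnions Ls)) x∈)
  ... | inj₁ x∈L = zero , s≤s z≤n , x∈L
  ... | inj₂ x∈U = let j , j<i , x∈Lj = ∈-prefixUnions⁻ Ls i x∈U in suc j , s≤s j<i , x∈Lj

  ∈-prefixUnions⁺ : {k : ℕ} {x : Fin n} (Ls : Vec (Subset n) k) (i : Fin (suc k)) →
    (∃ λ j → toℕ j < toℕ i × x ∈ lookup Ls j) → x ∈ lookup (prefixUnions Ls) i
  ∈-prefixUnions⁺ {x = x} (L ∷ Ls) (suc i) (j , j<i , x∈Lj) =
    subst (x ∈_) (sym (lookup-map i (L ∪_) (prefixUnions Ls))) (x∈p∪q⁺ (here-or-later j j<i x∈Lj))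
    where
    here-or-later : ∀ j → toℕ j < suc (toℕ i) → x ∈ lookup (L ∷ Ls) j →
                    x ∈ L ⊎ x ∈ lookup (prefixUnions Ls) i
    here-or-later zero _ x∈L = inj₁ x∈L
    here-or-later (suc j) (s≤s j<i) x∈Lj = inj₂ (∈-prefixUnions⁺ Ls i (j , j<i , x∈Lj))

  foldr-∪≡lookup-prefixUnions : {k : ℕ} (Ls : Vec (Subset n) k) →
    Vec.foldr (λ _ → Subset n) _∪_ ⊥ Ls ≡ lookup (prefixUnions Ls) (fromℕ k)
  foldr-∪≡lookup-prefixUnions [] = refl
  foldr-∪≡lookup-prefixUnions {suc k} (L ∷ Ls) =
    trans (cong (L ∪_) (foldr-∪≡lookup-prefixUnions Ls)) (sym (lookup-map (fromℕ k) (L ∪_) (prefixUnions Ls)))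

  PairwiseDisjoint : {k : ℕ} → Vec (Subset n) k → Set
  PairwiseDisjoint Ls = ∀ i j → i ≢ j → Empty (lookup Ls i ∩ lookup Ls j)

  blocks-prefixUnions : {k : ℕ} (Ls : Vec (Subset n) k) → PairwiseDisjoint Ls → blocks (prefixUnions Ls) ≡ Ls
  blocks-prefixUnions {k} Ls disjoint = lookup-ext λ j →
    trans (lookup-blocks (prefixUnions Ls) j) (⊆-antisym (block⊆ j) (⊆block j))
    where
    U : Vec (Subset n) (suc k)
    U = prefixUnions Ls
    block⊆ : ∀ j → lookup U (suc j) ─ lookup U (inject₁ j) ⊆ lookup Ls j
    block⊆ j {x} x∈ with ∈-prefixUnions⁻ Ls (suc j) (p─q⊆p _ _ x∈)
    ... | j′ , s≤s j′≤j , x∈Lj′ with ℕ.m≤n⇒m<n∨m≡n j′≤j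
    ...   | inj₂ j′≡j = subst (λ i → x ∈ lookup Ls i) (Fin.toℕ-injective j′≡j) x∈Lj′
    ...   | inj₁ j′<j = ⊥-elim (x∈p─q⇒x∉q _ _ x∈
                          (∈-prefixUnions⁺ Ls (inject₁ j) (j′ , subst (toℕ j′ <_) (sym (Fin.toℕ-inject₁ j)) j′<j , x∈Lj′)))
    ⊆block : ∀ j → lookup Ls j ⊆ lookup U (suc j) ─ lookup U (inject₁ j)
    ⊆block j {x} x∈Lj = x∈p∧x∉q⇒x∈p─q (∈-prefixUnions⁺ Ls (suc j) (j , ℕ.≤-refl , x∈Lj)) λ x∈ →
      let j′ , j′<j , x∈Lj′ = ∈-prefixUnions⁻ Ls (inject₁ j) x∈ in
      disjoint j′ j (λ j′≡j → ℕ.<-irrefl (cong toℕ j′≡j) (subst (toℕ j′ <_) (Fin.toℕ-inject₁ j) j′<j))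
        (x , x∈p∩q⁺ (x∈Lj′ , x∈Lj))

  restricted-head : {k : ℕ} (F : Vec (Subset n) (suc k)) → IsRestrictedFlag F → head F ≡ ⊥
  restricted-head {zero} (_ ∷ []) = proj₁
  restricted-head {suc k} (_ ∷ _) = proj₁

  restricted-last : {k : ℕ} (F : Vec (Subset n) (suc k)) → IsRestrictedFlag F → lookup F (fromℕ k) ≡ ⊤
  restricted-last {zero} (_ ∷ []) = proj₁ ∘ proj₂
  restricted-last {suc k} (_ ∷ _) = proj₁ ∘ proj₂

  restricted-chain : {k : ℕ} (F : Vec (Subset n) (suc k)) → IsRestrictedFlag F → IsChain F
  restricted-chain {zero} (_ ∷ []) = proj₂ ∘ proj₂
  restricted-chain {suc k} (_ ∷ _) = proj₁ ∘ proj₂ ∘ proj₂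

  restricted-blocks-nonempty : {k : ℕ} (F : Vec (Subset n) (suc k)) → IsRestrictedFlag F →
    ∀ j → Nonempty (lookup (blocks F) j)
  restricted-blocks-nonempty {suc k} F@(_ ∷ _) (_ , _ , _ , t≥1 , _) j =
    ∣p∣>0⇒Nonempty _ (subst (1 ≤_) (trans (cong (λ ts → lookup ts j) (flagType≡map-∣blocks∣ F))
                                            (lookup-map j ∣_∣ (blocks F))) (t≥1 j))

  MaxCond-lookup : {k : ℕ} (W : Vec (Subset n) (suc k)) → MaxCond W →
    ∀ j → ∃ λ m → IsMaxOf m (lookup W (suc j)) × m ∉ lookup W (inject₁ j)
  MaxCond-lookup (a ∷ b ∷ W) (max , _) zero = max
  MaxCond-lookup (a ∷ b ∷ W) (_ , maxCond) (suc j) = MaxCond-lookup (b ∷ W) maxCond j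

  restricted-max : {k : ℕ} (F : Vec (Subset n) (suc k)) → IsRestrictedFlag F →
    ∀ j → 1 ≤ toℕ j → ∃ λ m → IsMaxOf m (lookup F (suc j)) × m ∉ lookup F (inject₁ j)
  restricted-max {suc k} (_ ∷ W) (_ , _ , _ , _ , maxCond) (suc j) _ = MaxCond-lookup W maxCond j

  module Chain {k : ℕ} (F : Vec (Subset n) (suc k)) (head≡⊥ : head F ≡ ⊥) (chain : IsChain F) where

    ∈-block⇒∈-later : {x : Fin n} (i : Fin k) (i′ : Fin (suc k)) → toℕ i < toℕ i′ →
      x ∈ lookup (blocks F) i → x ∈ lookup F i′
    ∈-block⇒∈-later {x} i i′ i<i′ x∈ =
      subst (λ G → x ∈ lookup G i′) (prefixUnions-blocks F head≡⊥ chain)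
            (∈-prefixUnions⁺ (blocks F) i′ (i , i<i′ , x∈))

    ∈-block⇒∉-earlier : {x : Fin n} (j : Fin k) → x ∈ lookup (blocks F) j → x ∉ lookup F (inject₁ j)
    ∈-block⇒∉-earlier {x} j x∈ = x∈p─q⇒x∉q (lookup F (suc j)) _ (subst (x ∈_) (lookup-blocks F j) x∈)

    <⇒<inject₁ : {i j : Fin k} → i Fin.< j → toℕ i < toℕ (inject₁ j)
    <⇒<inject₁ {i} {j} i<j = subst (toℕ i <_) (sym (Fin.toℕ-inject₁ j)) i<j

    blocks-disjoint : PairwiseDisjoint (blocks F)
    blocks-disjoint i j i≢j (x , x∈) with x∈p∩q⁻ _ _ x∈ | Fin.<-cmp i j
    ... | x∈i , x∈j | tri< i<j _ _ =
      ∈-block⇒∉-earlier j x∈j (∈-block⇒∈-later i (inject₁ j) (<⇒<inject₁ i<j) x∈i)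
    ... | _ | tri≈ _ i≡j _ = i≢j i≡j
    ... | x∈i , x∈j | tri> _ _ j<i =
      ∈-block⇒∉-earlier i x∈i (∈-block⇒∈-later j (inject₁ i) (<⇒<inject₁ j<i) x∈j)

    max-block : {m : Fin n} (j : Fin k) → IsMaxOf m (lookup F (suc j)) → m ∉ lookup F (inject₁ j) →
      IsMaxOf m (lookup (blocks F) j)
    max-block {m} j (m∈ , ≤m) m∉ =
      subst (m ∈_) (sym (lookup-blocks F j)) (x∈p∧x∉q⇒x∈p─q m∈ m∉) ,
      λ x x∈ → ≤m x (∈-block⇒∈-later j (suc j) ℕ.≤-refl x∈)

    ∈-block<max-later-block : {x m : Fin n} {i j : Fin k} → i Fin.< j → x ∈ lookup (blocks F) i →
      IsMaxOf m (lookup F (suc j)) → m ∉ lookup F (inject₁ j) → x Fin.< m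
    ∈-block<max-later-block {x} {m} {i} {j} i<j x∈ (_ , ≤m) m∉ =
      Fin.≤∧≢⇒< (≤m x (∈-block⇒∈-later i (suc j) (ℕ.m<n⇒m<1+n i<j) x∈))
                λ { refl → m∉ (∈-block⇒∈-later i (inject₁ j) (<⇒<inject₁ i<j) x∈) }

  BlockwiseBonsais : {k : ℕ} → Vec (Subset n) (suc k) → Vec (BonsaiData n) k → Set
  BlockwiseBonsais F = Pointwise (λ L B → labels B ≡ L × IsBonsai B) (blocks F)

  blockwise-roots-increasing : {k : ℕ} {F : Vec (Subset n) (suc k)} {Bs : Vec (BonsaiData n) k} →
    IsRestrictedFlag F → BlockwiseBonsais F Bs →
    ∀ i j → i Fin.< j → ∀ r r′ → IsRootedTree (lookup Bs i) r → IsRootedTree (lookup Bs j) r′ → r Fin.< r′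
  blockwise-roots-increasing {F = F} {Bs} flag bonsais i j i<j r r′ rooted rooted′
    with restricted-max F flag j (ℕ.≤-trans (s≤s z≤n) i<j) | proj₂ (Pointwise.lookup bonsais j)
  ... | m , max-m , m∉ | r₀ , rooted₀ , max-r₀ =
    subst (r Fin.<_) (sym r′≡m) (∈-block<max-later-block i<j (subst (r ∈_) (labels-block i) (proj₁ rooted)) max-m m∉)
    where
    open Chain F (restricted-head F flag) (restricted-chain F flag)
    labels-block : ∀ i → labels (lookup Bs i) ≡ lookup (blocks F) i
    labels-block i = proj₁ (Pointwise.lookup bonsais i)
    r′≡m : r′ ≡ m
    r′≡m = trans (root-unique rooted′ rooted₀)
                 (Greatest-unique (subst (IsMaxOf r₀) (labels-block j) max-r₀) (max-block j max-m m∉))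

  blockwise⇒bonsaiSequence : {k : ℕ} {F : Vec (Subset n) (suc k)} {Bs : Vec (BonsaiData n) k} →
    IsRestrictedFlag F → BlockwiseBonsais F Bs → IsBonsaiSequence Bs × associatedFlag Bs ≡ F
  blockwise⇒bonsaiSequence {k} {F} {Bs} flag bonsais =
    ((λ i → proj₂ (Pointwise.lookup bonsais i)) , disjoint , union≡⊤ , blockwise-roots-increasing flag bonsais) , flag≡
    where
    open Chain F (restricted-head F flag) (restricted-chain F flag)
    flag≡ : associatedFlag Bs ≡ F
    flag≡ = trans (cong prefixUnions (Pointwise-graph⇒map≡ bonsais))
                  (prefixUnions-blocks F (restricted-head F flag) (restricted-chain F flag))
    disjoint : ∀ i j → i ≢ j → Empty (labels (lookup Bs i) ∩ labels (lookup Bs j))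
    disjoint i j i≢j = subst₂ (λ X Y → Empty (X ∩ Y)) (sym (proj₁ (Pointwise.lookup bonsais i)))
                              (sym (proj₁ (Pointwise.lookup bonsais j))) (blocks-disjoint i j i≢j)
    union≡⊤ : Vec.foldr (λ _ → Subset n) _∪_ ⊥ (Vec.map labels Bs) ≡ ⊤
    union≡⊤ = trans (foldr-∪≡lookup-prefixUnions (Vec.map labels Bs))
                    (trans (cong (λ G → lookup G (fromℕ k)) flag≡) (restricted-last F flag))

  bonsaiSequence⇒blockwise : {k : ℕ} {F : Vec (Subset n) (suc k)} {Bs : Vec (BonsaiData n) k} →
    IsBonsaiSequence Bs → associatedFlag Bs ≡ F → BlockwiseBonsais F Bs
  bonsaiSequence⇒blockwise {Bs = Bs} (bonsai , disjoint , _ , _) refl = map≡⇒Pointwise-graph Bs labels≡ bonsai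
    where
    labels-disjoint : PairwiseDisjoint (Vec.map labels Bs)
    labels-disjoint i j i≢j =
      subst₂ (λ X Y → Empty (X ∩ Y)) (sym (lookup-map i labels Bs)) (sym (lookup-map j labels Bs)) (disjoint i j i≢j)
    labels≡ : Vec.map labels Bs ≡ blocks (associatedFlag Bs)
    labels≡ = sym (blocks-prefixUnions (Vec.map labels Bs) labels-disjoint)

  productPow-map : {k : ℕ} {A : Set} (f : A → ℕ) (xs : Vec A k) →
    productPow (Vec.map f xs) ≡ Vec.foldr′ _*_ 1 (Vec.map (λ x → f x ^ (f x ∸ 2)) xs)
  productPow-map f [] = refl
  productPow-map f (x ∷ xs) = cong (f x ^ (f x ∸ 2) *_) (productPow-map f xs)

  HasCount-BlockwiseBonsais : {k : ℕ} (F : Vec (Subset n) (suc k)) → IsRestrictedFlag F →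
    HasCount (BlockwiseBonsais F) (productPow (flagType F))
  HasCount-BlockwiseBonsais F flag =
    subst (HasCount _) (sym (trans (cong productPow (flagType≡map-∣blocks∣ F)) (productPow-map ∣_∣ (blocks F))))
      (HasCount-Pointwise (λ L → ∣ L ∣ ^ (∣ L ∣ ∸ 2)) (blocks F) λ j →
        let x , x∈ = restricted-blocks-nonempty F flag j in
        HasCount-bonsai (lookup (blocks F) j) (greatest-greatest x (_∈? lookup (blocks F) j) x∈))

mainTheorem12 : (n k : ℕ) (F : Vec (Subset n) (suc k)) → IsRestrictedFlag F →
    HasCount (λ (Bs : Vec (BonsaiData n) k) → IsBonsaiSequence Bs × associatedFlag Bs ≡ F)
      (productPow (flagType F))
mainTheorem12 n k F flag =
  HasCount-resp (λ Bs → mk⇔ (blockwise⇒bonsaiSequence flag) (uncurry bonsaiSequence⇒blockwise))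
    (HasCount-BlockwiseBonsais F flag)
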